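{- $f(6) \neq 12$; that is, there is no $6$-partite intersecting hypergraph $\mathcal{H}$ with exactly $12$ edges and $\tau(\mathcal{H}) = 5$.
   Context: A hypergraph consists of a vertex set and a set of edges, each a nonempty subset of the vertex set. It is $r$-partite if its vertex set can be partitioned into $r$ parts such that every edge contains exactly one vertex from each part. It is intersecting if every two edges share at least one vertex. $\tau(\mathcal{H})$ denotes the minimum size of a set of vertices meeting every edge of $\mathcal{H}$. For $r\ge 2$, $f(r)$ is the minimum integer such that there exists an $r$-partite intersecting hypergraph $\mathcal{H}$ with $\tau(\mathcal{H}) = r-1$ and exactly $f(r)$ edges. -}

module Defs where

open import Data.Nat using (ℕ; _<_)
open import Data.Fin using (Fin)
open import Data.Product using (Σ; ∃; _×_; _,_)
open import Data.List using (List; length)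
open import Data.List.Membership.Propositional using (_∈_)
open import Data.List.Relation.Unary.Any using (Any)
open import Relation.Binary.PropositionalEquality using (_≡_)
open import Relation.Nullary using (¬_)
open import Function.Definitions using (Injective)

-- Vertices are pairs (i , x) with
-- i : Fin r the part and x : ℕ a label within that part; the vertex set
-- (WLOG countable, only vertices lying on edges matter for τ) is Fin r × ℕ
-- partitioned by the first coordinate. An edge is a choice of exactly one
-- vertex from each part, i.e. a function Fin r → ℕ.
Edge : ℕ → Set
Edge r = Fin r → ℕ

Vertex : ℕ → Set
Vertex r = Σ (Fin r) (λ _ → ℕ)

Hypergraph : ℕ → ℕ → Set
Hypergraph r m = Fin m → Edge r

_∈ᵉ_ : ∀ {r} → Vertex r → Edge r → Set
(i , x) ∈ᵉ e = e i ≡ x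

Simple : ∀ {r m} → Hypergraph r m → Set
Simple H = Injective _≡_ _≡_ H

Intersecting : ∀ {r m} → Hypergraph r m → Set
Intersecting {r} H = ∀ a b → ∃ λ (i : Fin r) → H a i ≡ H b i

IsCover : ∀ {r m} → Hypergraph r m → List (Vertex r) → Set
IsCover H C = ∀ a → Any (λ v → v ∈ᵉ H a) C

-- τ(H) = k : some cover has k vertices and no cover has fewer
-- (covers are lists; duplicates only increase length, so the minimum
-- length equals the minimum cardinality of a covering vertex set)
τ≡ : ∀ {r m} → Hypergraph r m → ℕ → Set
τ≡ H k = (∃ λ C → IsCover H C × length C ≡ k)
       × (∀ C → IsCover H C → ¬ (length C < k))

module Submission where

-- f(6) ≠ 12: no 6-partite intersecting hypergraph with 12 edges has cover
-- number 5. Let H be one; then no four vertices meet all twelve edges.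
--  * Counting over Fin n: finite sums, boolean counts, inclusion–exclusion,
--    saturation of sums, and divisibility of multiplicity classes.
--  * Covering capacities of intersecting r-partite hypergraphs: any 2 edges
--    are met by 1 vertex, any 4 by 2, and for r = 6 (by a parity argument)
--    any 7 by 3. As H has no 4-cover, k = 1, 2, 3, 4 vertices of H meet at
--    most 4, 7, 9, 11 edges.
--  * In each column, greedy packing bounds the number c_j of edges whose
--    vertex there has degree j, so the column's excess Σ (degree − 1) is
--    3 c₄ + 2 c₃ + c₂ ≤ 22, with equality only if c₄ ≥ 1.
--  * Each edge meets the other eleven, so its excess is at least 11. Double
--    counting, 12 · 11 ≤ total ≤ 6 · 22: every column has a vertex of
--    degree 4 (a hub) and any two edges share exactly one vertex.
--  * Two hubs share exactly one edge and no edge contains three hubs, so the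
--    hub of column 0 would lie on five edges, contradicting degree 4.

open import Defs
open import Data.Product using (∃; _×_)
open import Relation.Nullary using (¬_)

open import Data.Nat using (ℕ; zero; suc; _+_; _*_; _∸_; _≤_; _<_; z≤n; s≤s; _≤?_; _≟_; _≡ᵇ_)
open import Data.Nat.Properties
open import Data.Nat.Divisibility using (_∣_; _∣?_; _∣0; ∣-refl; ∣m∣n⇒∣m+n; n∣m⇒m%n≡0)
open import Data.Fin using (Fin; zero; suc) renaming (_≟_ to _≟ᶠ_)
open import Data.Fin.Properties using (any?) renaming (suc-injective to Fin-suc-injective)
open import Data.Bool using (Bool; true; false; _∧_; _∨_; not; T)
open import Data.Bool.Properties using (T-∧; T-∨; T-not-≡; T-≡; ∧-identityʳ; ∧-zeroʳ; ∨-identityʳ; ∨-assoc)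
open import Data.Product using (∃₂; _,_; proj₁; proj₂)
open import Data.Sum using (inj₁; inj₂)
open import Data.List using (List; []; _∷_; length; _++_; map)
open import Data.List.Properties using (length-++; length-map)
open import Data.List.Relation.Unary.All using (All; []; _∷_)
open import Data.List.Relation.Unary.Any using (Any; here; there)
open import Data.Empty using (⊥; ⊥-elim)
open import Function using (_∘_)
open import Function.Bundles using (Equivalence)
open Equivalence using (to; from)
open import Relation.Nullary using (Dec; yes; no; contradiction)
open import Relation.Nullary.Decidable using (T?; _×-dec_; _→-dec_; toWitness)
open import Relation.Binary.PropositionalEquality
open import Algebra.Properties.Semiring.Sum +-*-semiring using (sum; ∑-comm; ∑-distrib-+; sum-cong-≗; *-distribˡ-sum)

sum-mono : ∀ {n} {f g : Fin n → ℕ} → (∀ k → f k ≤ g k) → sum f ≤ sum g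
sum-mono {zero} _ = z≤n
sum-mono {suc n} f≤g = +-mono-≤ (f≤g zero) (sum-mono (f≤g ∘ suc))

sum-const : ∀ n c → sum {n} (λ _ → c) ≡ n * c
sum-const zero c = refl
sum-const (suc n) c = cong (c +_) (sum-const n c)

term≤sum : ∀ {n} (f : Fin n → ℕ) k → f k ≤ sum f
term≤sum f zero = m≤m+n _ _
term≤sum f (suc k) = ≤-trans (term≤sum (f ∘ suc) k) (m≤n+m _ _)

two-terms≤sum : ∀ {n} (f : Fin n → ℕ) {k l} → k ≢ l → f k + f l ≤ sum f
two-terms≤sum f {zero} {zero} k≢l = ⊥-elim (k≢l refl)
two-terms≤sum f {zero} {suc l} _ = +-monoʳ-≤ (f zero) (term≤sum (f ∘ suc) l)
two-terms≤sum f {suc k} {zero} _ =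
  subst (_≤ sum f) (+-comm (f zero) (f (suc k))) (+-monoʳ-≤ (f zero) (term≤sum (f ∘ suc) k))
two-terms≤sum f {suc k} {suc l} k≢l =
  ≤-trans (two-terms≤sum (f ∘ suc) (k≢l ∘ cong suc)) (m≤n+m _ _)

sum-∸ : ∀ {n} (g h : Fin n → ℕ) → (∀ k → h k ≤ g k) → sum g ≡ sum (λ k → g k ∸ h k) + sum h
sum-∸ g h h≤g = trans (sum-cong-≗ (λ k → sym (m∸n+n≡m (h≤g k)))) (∑-distrib-+ (λ k → g k ∸ h k) h)

sum-saturated-above : ∀ {n} (f : Fin n → ℕ) c → (∀ k → f k ≤ c) → n * c ≤ sum f → ∀ k → f k ≡ c
sum-saturated-above {suc n} f c f≤c full = saturated
  where
  rest≤ : sum (f ∘ suc) ≤ n * c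
  rest≤ = ≤-trans (sum-mono (f≤c ∘ suc)) (≤-reflexive (sum-const n c))
  saturated : ∀ k → f k ≡ c
  saturated zero = ≤-antisym (f≤c zero) (+-cancelʳ-≤ (n * c) c (f zero) (≤-trans full (+-monoʳ-≤ (f zero) rest≤)))
  saturated (suc k) = sum-saturated-above (f ∘ suc) c (f≤c ∘ suc)
    (+-cancelˡ-≤ c (n * c) (sum (f ∘ suc)) (≤-trans full (+-monoˡ-≤ _ (f≤c zero)))) k

sum-saturated-below : ∀ {n} (f : Fin n → ℕ) c → (∀ k → c ≤ f k) → sum f ≤ n * c → ∀ k → f k ≡ c
sum-saturated-below {suc n} f c c≤f full = saturated
  where
  rest≥ : n * c ≤ sum (f ∘ suc)
  rest≥ = ≤-trans (≤-reflexive (sym (sum-const n c))) (sum-mono (c≤f ∘ suc))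
  saturated : ∀ k → f k ≡ c
  saturated zero = ≤-antisym (+-cancelʳ-≤ (n * c) (f zero) c (≤-trans (+-monoʳ-≤ (f zero) rest≥) full)) (c≤f zero)
  saturated (suc k) = sum-saturated-below (f ∘ suc) c (c≤f ∘ suc)
    (+-cancelˡ-≤ c (sum (f ∘ suc)) (n * c) (≤-trans (+-monoˡ-≤ _ (c≤f zero)) full)) k

𝟙 : Bool → ℕ
𝟙 true = 1
𝟙 false = 0

count : ∀ {n} → (Fin n → Bool) → ℕ
count p = sum (λ a → 𝟙 (p a))

𝟙-true : ∀ {x} → T x → 𝟙 x ≡ 1
𝟙-true {true} _ = refl

module _ {n : ℕ} where

  count-cong : {p q : Fin n → Bool} → (∀ a → p a ≡ q a) → count p ≡ count q
  count-cong p≗q = sum-cong-≗ (cong 𝟙 ∘ p≗q)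

  count-mono : {p q : Fin n → Bool} → (∀ a → T (p a) → T (q a)) → count p ≤ count q
  count-mono p⊆q = sum-mono (λ a → 𝟙-mono (p⊆q a))
    where
    𝟙-mono : ∀ {x y} → (T x → T y) → 𝟙 x ≤ 𝟙 y
    𝟙-mono {false} _ = z≤n
    𝟙-mono {true} {true} _ = ≤-refl
    𝟙-mono {true} {false} x⇒y = ⊥-elim (x⇒y _)

  count-none : (p : Fin n → Bool) → (∀ a → ¬ T (p a)) → count p ≡ 0
  count-none p none = trans (count-cong (λ a → false-of (none a))) (trans (sum-const n 0) (*-zeroʳ n))
    where
    false-of : ∀ {x} → ¬ T x → x ≡ false
    false-of {false} _ = refl
    false-of {true} ¬t = ⊥-elim (¬t _)

  count-all : (p : Fin n → Bool) → (∀ a → T (p a)) → count p ≡ n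
  count-all p all = trans (count-cong (λ a → true-of (all a))) (trans (sum-const n 1) (*-identityʳ n))
    where
    true-of : ∀ {x} → T x → x ≡ true
    true-of {true} _ = refl

  count-member : (p : Fin n → Bool) {a : Fin n} → T (p a) → 1 ≤ count p
  count-member p {a} pa = ≤-trans (≤-reflexive (sym (𝟙-true pa))) (term≤sum (λ b → 𝟙 (p b)) a)

  count-two-members : (p : Fin n → Bool) {a b : Fin n} → a ≢ b → T (p a) → T (p b) → 2 ≤ count p
  count-two-members p a≢b pa pb =
    ≤-trans (≤-reflexive (sym (cong₂ _+_ (𝟙-true pa) (𝟙-true pb)))) (two-terms≤sum (λ c → 𝟙 (p c)) a≢b)

count-witness : ∀ {n} (p : Fin n → Bool) → 1 ≤ count p → ∃ λ a → T (p a)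
count-witness {suc n} p h with p zero in e
... | true = zero , subst T (sym e) _
... | false = let (a , pa) = count-witness (p ∘ suc) h in suc a , pa

count-two-witnesses : ∀ {n} (p : Fin n → Bool) → 2 ≤ count p →
                      ∃₂ λ a b → a ≢ b × T (p a) × T (p b)
count-two-witnesses {suc n} p h with p zero in e
... | true = let (b , pb) = count-witness (p ∘ suc) (≤-pred h) in zero , suc b , (λ ()) , subst T (sym e) _ , pb
... | false = let (a , b , a≢b , pa , pb) = count-two-witnesses (p ∘ suc) h in
              suc a , suc b , a≢b ∘ Fin-suc-injective , pa , pb

count-at-most-one : ∀ {n} (p : Fin n → Bool) → (∀ {a b} → a ≢ b → T (p a) → T (p b) → ⊥) → count p ≤ 1
count-at-most-one p unique with count p ≤? 1
... | yes ≤1 = ≤1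
... | no ≰1 = let (a , b , a≢b , pa , pb) = count-two-witnesses p (≰⇒> ≰1) in ⊥-elim (unique a≢b pa pb)

count≤1-unique : ∀ {n} (p : Fin n → Bool) → count p ≤ 1 → ∀ {a b} → T (p a) → T (p b) → a ≡ b
count≤1-unique p ≤1 {a} {b} pa pb with a ≟ᶠ b
... | yes a≡b = a≡b
... | no a≢b = contradiction (count-two-members p a≢b pa pb) (<⇒≱ (s≤s ≤1))

module _ {n : ℕ} (p q : Fin n → Bool) where

  count-split : count (λ a → p a ∧ q a) + count (λ a → p a ∧ not (q a)) ≡ count p
  count-split = trans (sym (∑-distrib-+ (λ a → 𝟙 (p a ∧ q a)) (λ a → 𝟙 (p a ∧ not (q a)))))
                      (sum-cong-≗ (λ a → pointwise (p a) (q a)))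
    where
    pointwise : ∀ x y → 𝟙 (x ∧ y) + 𝟙 (x ∧ not y) ≡ 𝟙 x
    pointwise true true = refl
    pointwise true false = refl
    pointwise false _ = refl

  count-union : count (λ a → p a ∨ q a) + count (λ a → p a ∧ q a) ≡ count p + count q
  count-union = trans (sym (∑-distrib-+ (λ a → 𝟙 (p a ∨ q a)) (λ a → 𝟙 (p a ∧ q a))))
               (trans (sum-cong-≗ (λ a → pointwise (p a) (q a))) (∑-distrib-+ (λ a → 𝟙 (p a)) (λ a → 𝟙 (q a))))
    where
    pointwise : ∀ x y → 𝟙 (x ∨ y) + 𝟙 (x ∧ y) ≡ 𝟙 x + 𝟙 y
    pointwise true _ = refl
    pointwise false true = refl
    pointwise false false = refl

  count-difference : count q < count p → ∃ λ a → T (p a) × ¬ T (q a)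
  count-difference q<p =
    let (a , t) = count-witness (λ a → p a ∧ not (q a)) (+-cancelˡ-≤ (count q) 1 _ room)
        (pa , ¬qa) = to T-∧ t
    in a , pa , λ qa → subst T (to T-not-≡ ¬qa) qa
    where
    room : count q + 1 ≤ count q + count (λ a → p a ∧ not (q a))
    room = begin
      count q + 1                                  ≡⟨ +-comm (count q) 1 ⟩
      suc (count q)                                ≤⟨ q<p ⟩
      count p                                      ≡⟨ count-split ⟨
      count (λ a → p a ∧ q a) + count (λ a → p a ∧ not (q a))
        ≤⟨ +-monoˡ-≤ _ (count-mono {p = λ a → p a ∧ q a} {q = q} (λ a → proj₂ ∘ to T-∧)) ⟩
      count q + count (λ a → p a ∧ not (q a))      ∎
      where open ≤-Reasoning

≡ᵇ-true : ∀ m n → (m ≡ᵇ n) ≡ true → m ≡ n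
≡ᵇ-true m n e = ≡ᵇ⇒≡ m n (from T-≡ e)

-- The members of S whose label has multiplicity exactly j fall
-- into classes of size j, so their number is divisible by j.
module Multiplicity {m : ℕ} (f : Fin m → ℕ) where

  multiplicity : (Fin m → Bool) → ℕ → ℕ
  multiplicity S x = count (λ b → S b ∧ (f b ≡ᵇ x))

  with-multiplicity : ℕ → (Fin m → Bool) → ℕ
  with-multiplicity j S = count (λ a → S a ∧ (multiplicity S (f a) ≡ᵇ j))

  _without_ : (Fin m → Bool) → ℕ → (Fin m → Bool)
  (S without x) a = S a ∧ not (f a ≡ᵇ x)

  without-multiplicity : ∀ S x a → (f a ≡ᵇ x) ≡ false →
                         multiplicity (S without x) (f a) ≡ multiplicity S (f a)
  without-multiplicity S x a fa≢x = count-cong pointwise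
    where
    pointwise : ∀ b → (S b ∧ not (f b ≡ᵇ x)) ∧ (f b ≡ᵇ f a) ≡ S b ∧ (f b ≡ᵇ f a)
    pointwise b with f b ≡ᵇ f a in fb≡fa
    ... | false = trans (∧-zeroʳ _) (sym (∧-zeroʳ _))
    ... | true = begin
      (S b ∧ not (f b ≡ᵇ x)) ∧ true  ≡⟨ cong (λ y → (S b ∧ not (y ≡ᵇ x)) ∧ true) (≡ᵇ-true (f b) (f a) fb≡fa) ⟩
      (S b ∧ not (f a ≡ᵇ x)) ∧ true  ≡⟨ cong (λ t → (S b ∧ not t) ∧ true) fa≢x ⟩
      (S b ∧ true) ∧ true            ≡⟨ cong (_∧ true) (∧-identityʳ (S b)) ⟩
      S b ∧ true                     ∎
      where open ≡-Reasoning

  without-shrinks : ∀ S {a} → T (S a) → suc (count (S without f a)) ≤ count S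
  without-shrinks S {a} Sa = begin
    suc (count (S without f a))                                       ≤⟨ +-monoˡ-≤ _ a-in-class ⟩
    count (λ b → S b ∧ (f b ≡ᵇ f a)) + count (S without f a)          ≡⟨ count-split S (λ b → f b ≡ᵇ f a) ⟩
    count S                                                           ∎
    where
    open ≤-Reasoning
    a-in-class : 1 ≤ count (λ b → S b ∧ (f b ≡ᵇ f a))
    a-in-class = count-member (λ b → S b ∧ (f b ≡ᵇ f a)) (from T-∧ (Sa , ≡⇒≡ᵇ (f a) (f a) refl))

  module _ (j : ℕ) where

    class-of : (Fin m → Bool) → ℕ → (Fin m → Bool)
    class-of S x a = (S a ∧ (f a ≡ᵇ x)) ∧ (multiplicity S x ≡ᵇ j)

    class-split : ∀ S x → with-multiplicity j S ≡ with-multiplicity j (S without x) + count (class-of S x)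
    class-split S x = trans (sum-cong-≗ pointwise)
      (∑-distrib-+ (λ a → 𝟙 ((S without x) a ∧ (multiplicity (S without x) (f a) ≡ᵇ j))) (λ a → 𝟙 (class-of S x a)))
      where
      in-class : ∀ {y} → y ≡ x → ∀ s b → 𝟙 (s ∧ (multiplicity S y ≡ᵇ j)) ≡
                 𝟙 ((s ∧ false) ∧ b) + 𝟙 ((s ∧ true) ∧ (multiplicity S x ≡ᵇ j))
      in-class refl true _ = refl
      in-class refl false _ = refl

      out-of-class : ∀ {k l} → k ≡ l → ∀ s b →
                     𝟙 (s ∧ (l ≡ᵇ j)) ≡ 𝟙 ((s ∧ true) ∧ (k ≡ᵇ j)) + 𝟙 ((s ∧ false) ∧ b)
      out-of-class refl true _ = sym (+-identityʳ _)
      out-of-class refl false _ = refl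

      pointwise : ∀ a → 𝟙 (S a ∧ (multiplicity S (f a) ≡ᵇ j)) ≡
                        𝟙 ((S without x) a ∧ (multiplicity (S without x) (f a) ≡ᵇ j)) + 𝟙 (class-of S x a)
      pointwise a with f a ≡ᵇ x in fa≟x
      ... | true = in-class (≡ᵇ-true (f a) x fa≟x) (S a) _
      ... | false = out-of-class (without-multiplicity S x a fa≟x) (S a) _

    class-divisible : ∀ S x → j ∣ count (class-of S x)
    class-divisible S x with multiplicity S x ≡ᵇ j in size
    ... | true = subst (j ∣_) (sym full) ∣-refl
      where
      full : count (λ a → (S a ∧ (f a ≡ᵇ x)) ∧ true) ≡ j
      full = trans (count-cong (λ a → ∧-identityʳ (S a ∧ (f a ≡ᵇ x)))) (≡ᵇ-true _ j size)
    ... | false = subst (j ∣_) (sym empty) (j ∣0)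
      where
      empty : count (λ a → (S a ∧ (f a ≡ᵇ x)) ∧ false) ≡ 0
      empty = count-none _ (λ a → subst T (∧-zeroʳ (S a ∧ (f a ≡ᵇ x))))

    with-multiplicity≤ : ∀ S → with-multiplicity j S ≤ count S
    with-multiplicity≤ S = count-mono {p = λ a → S a ∧ (multiplicity S (f a) ≡ᵇ j)} {q = S} (λ a → proj₁ ∘ to T-∧)

    classes-divisible : ∀ n S → count S ≤ n → j ∣ with-multiplicity j S
    classes-divisible n S bound with 1 ≤? count S
    ... | no empty = subst (j ∣_) (sym (n≤0⇒n≡0 (≤-trans (with-multiplicity≤ S) (≤-pred (≰⇒> empty))))) (j ∣0)
    classes-divisible zero S bound | yes nonempty = contradiction (≤-trans nonempty bound) λ ()
    classes-divisible (suc n) S bound | yes nonempty =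
      let (a , Sa) = count-witness S nonempty in
      subst (j ∣_) (sym (class-split S (f a)))
        (∣m∣n⇒∣m+n (classes-divisible n (S without f a) (≤-pred (≤-trans (without-shrinks S Sa) bound)))
                   (class-divisible S (f a)))

-- The weight bound for one column of the final configuration: with c₂, c₃, c₄
-- edges whose vertex in the column has degree 2, 3, 4, the column carries
-- 3 c₄ + 2 c₃ + c₂ ≤ 22 excess incidences, with equality only if c₄ ≥ 1.
-- Only the parity of c₂ and the three stated bounds matter; the proof is a
-- finite check over the bounded range.
column-weight : ℕ → ℕ → ℕ → ℕ
column-weight c₂ c₃ c₄ = 3 * c₄ + 2 * c₃ + c₂

ColumnWeightBound : ℕ → ℕ → ℕ → Set
ColumnWeightBound c₂ c₃ c₄ = 2 ∣ c₂ → c₂ + c₃ + c₄ ≤ 12 → (1 ≤ c₄ → c₃ ≤ 3) →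
  column-weight c₂ c₃ c₄ ≤ 22 × (column-weight c₂ c₃ c₄ ≡ 22 → 1 ≤ c₄)

column-weight-bound : ∀ c₂ c₃ c₄ → c₃ ≤ 9 → c₄ ≤ 4 → ColumnWeightBound c₂ c₃ c₄
column-weight-bound c₂ c₃ c₄ c₃≤9 c₄≤4 2∣c₂ total≤12 =
  checked (s≤s c₄≤4) (s≤s c₃≤9) (s≤s c₂≤12) 2∣c₂ total≤12
  where
  c₂≤12 : c₂ ≤ 12
  c₂≤12 = ≤-trans (m≤m+n c₂ c₃) (≤-trans (m≤m+n (c₂ + c₃) c₄) total≤12)
  decide : ∀ c₂ c₃ c₄ → Dec (ColumnWeightBound c₂ c₃ c₄)
  decide c₂ c₃ c₄ = (2 ∣? c₂) →-dec ((c₂ + c₃ + c₄ ≤? 12) →-dec (((1 ≤? c₄) →-dec (c₃ ≤? 3)) →-dec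
    ((column-weight c₂ c₃ c₄ ≤? 22) ×-dec ((column-weight c₂ c₃ c₄ ≟ 22) →-dec (1 ≤? c₄)))))
  checked : ∀ {c₄} → c₄ < 5 → ∀ {c₃} → c₃ < 10 → ∀ {c₂} → c₂ < 13 → ColumnWeightBound c₂ c₃ c₄
  checked = toWitness {a? = allUpTo? (λ c₄ → allUpTo? (λ c₃ → allUpTo? (λ c₂ → decide c₂ c₃ c₄) 13) 10) 5} _

module Incidence {r m : ℕ} (H : Hypergraph r m) where

  _∈ᵇ_ : Vertex r → Fin m → Bool
  (i , x) ∈ᵇ a = H a i ≡ᵇ x

  own-vertex : ∀ a i → T ((i , H a i) ∈ᵇ a)
  own-vertex a i = ≡⇒≡ᵇ (H a i) (H a i) refl

  all-edges : Fin m → Bool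
  all-edges _ = true

  covers : List (Vertex r) → Fin m → Bool
  covers [] a = false
  covers (v ∷ C) a = (v ∈ᵇ a) ∨ covers C a

  covers-++ : ∀ C C' a → covers (C ++ C') a ≡ covers C a ∨ covers C' a
  covers-++ [] C' a = refl
  covers-++ (v ∷ C) C' a = trans (cong ((v ∈ᵇ a) ∨_) (covers-++ C C' a)) (sym (∨-assoc (v ∈ᵇ a) _ _))

  covers-sound : ∀ C a → T (covers C a) → Any (λ v → v ∈ᵉ H a) C
  covers-sound ((i , x) ∷ C) a t with H a i ≡ᵇ x in on
  ... | true = here (≡ᵇ-true (H a i) x on)
  ... | false = there (covers-sound C a t)

  reach : List (Vertex r) → ℕ
  reach C = count (covers C)

  reach-cons : ∀ v C → reach (v ∷ C) + count (λ a → (v ∈ᵇ a) ∧ covers C a) ≡ count (v ∈ᵇ_) + reach C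
  reach-cons v C = count-union (v ∈ᵇ_) (covers C)

  agree-at : ∀ {i x b c} → T ((i , x) ∈ᵇ b) → T ((i , x) ∈ᵇ c) → T (H c i ≡ᵇ H b i)
  agree-at {i} {x} {b} {c} tb tc = ≡⇒≡ᵇ (H c i) (H b i) (trans (≡ᵇ⇒≡ _ _ tc) (sym (≡ᵇ⇒≡ _ _ tb)))

  Covers : List (Vertex r) → (Fin m → Bool) → Set
  Covers C S = ∀ a → T (S a) → T (covers C a)

  degree : (Fin m → Bool) → Vertex r → ℕ
  degree S v = count (λ a → S a ∧ (v ∈ᵇ a))

  _minus_ : (Fin m → Bool) → Vertex r → (Fin m → Bool)
  (S minus v) a = S a ∧ not (v ∈ᵇ a)

  minus-covers : ∀ S v C → Covers C (S minus v) → Covers (v ∷ C) S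
  minus-covers S v C cover a Sa with v ∈ᵇ a in on
  ... | true = _
  ... | false = cover a (from T-∧ (Sa , from T-not-≡ on))

  CoverCapacity : ℕ → ℕ → Set
  CoverCapacity k n = ∀ S → count S ≤ n → ∃ λ C → length C ≤ k × Covers C S

  capacity-zero : CoverCapacity 0 0
  capacity-zero S empty = [] , z≤n , λ a Sa → contradiction (≤-trans (count-member S Sa) empty) λ ()

  capacity-weaken : ∀ {k k' n} → k ≤ k' → CoverCapacity k n → CoverCapacity k' n
  capacity-weaken k≤k' capacity S bound =
    let (C , |C|≤k , cover) = capacity S bound in C , ≤-trans |C|≤k k≤k' , cover

  capacity-step : ∀ {k n} → CoverCapacity k n → ∀ S v → count S ≤ degree S v + n →
                  ∃ λ C → length C ≤ suc k × Covers C S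
  capacity-step capacity S v bound =
    let rest≤n = +-cancelˡ-≤ (degree S v) _ _ (≤-trans (≤-reflexive (count-split S (v ∈ᵇ_))) bound)
        (C , |C|≤k , cover) = capacity (S minus v) rest≤n
    in v ∷ C , s≤s |C|≤k , minus-covers S v C cover

  agreement : (Fin m → Bool) → Fin m → Fin m → ℕ
  agreement S a b = count (λ i → S b ∧ (H b i ≡ᵇ H a i))

  -- Double counting the pairs (column i, edge b of S) with b through the
  -- vertex of a in column i.
  degree-sum : ∀ S a → sum (λ i → degree S (i , H a i)) ≡ sum (agreement S a)
  degree-sum S a = ∑-comm (λ i b → 𝟙 (S b ∧ (H b i ≡ᵇ H a i)))

  agreement-self : ∀ S a → T (S a) → agreement S a a ≡ r
  agreement-self S a Sa = count-all _ (λ i → from T-∧ (Sa , own-vertex a i))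

  module _ (intersecting : Intersecting H) where

    shared : Fin m → Fin m → Vertex r
    shared a b = proj₁ (intersecting a b) , H a (proj₁ (intersecting a b))

    shared-left : ∀ a b → T (shared a b ∈ᵇ a)
    shared-left a b = own-vertex a (proj₁ (intersecting a b))

    shared-right : ∀ a b → T (shared a b ∈ᵇ b)
    shared-right a b = ≡⇒≡ᵇ _ _ (sym (proj₂ (intersecting a b)))

    vertex-of-degree-1 : ∀ S → 1 ≤ count S → ∃ λ v → 1 ≤ degree S v
    vertex-of-degree-1 S nonempty =
      let (a , Sa) = count-witness S nonempty in
      shared a a , count-member (λ b → S b ∧ (shared a a ∈ᵇ b)) (from T-∧ (Sa , shared-left a a))

    vertex-of-degree-2 : ∀ S → 2 ≤ count S → ∃ λ v → 2 ≤ degree S v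
    vertex-of-degree-2 S two =
      let (a , b , a≢b , Sa , Sb) = count-two-witnesses S two in
      shared a b , count-two-members (λ c → S c ∧ (shared a b ∈ᵇ c)) a≢b
                     (from T-∧ (Sa , shared-left a b)) (from T-∧ (Sb , shared-right a b))

    capacity-1-2 : CoverCapacity 1 2
    capacity-1-2 S ≤2 with 2 ≤? count S | 1 ≤? count S
    ... | yes ≥2 | _ = let (v , d) = vertex-of-degree-2 S ≥2 in
      capacity-step capacity-zero S v (m≤n⇒m≤n+o 0 (≤-trans ≤2 d))
    ... | no ≱2 | yes ≥1 = let (v , d) = vertex-of-degree-1 S ≥1 in
      capacity-step capacity-zero S v (m≤n⇒m≤n+o 0 (≤-trans (≤-pred (≰⇒> ≱2)) d))
    ... | no _ | no ≱1 = capacity-weaken z≤n capacity-zero S (≤-pred (≰⇒> ≱1))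

    capacity-2-4 : CoverCapacity 2 4
    capacity-2-4 S ≤4 with count S ≤? 2
    ... | yes ≤2 = capacity-weaken (n≤1+n 1) capacity-1-2 S ≤2
    ... | no ≰2 = let (v , d) = vertex-of-degree-2 S (≤-trans (n≤1+n 2) (≰⇒> ≰2)) in
      capacity-step capacity-1-2 S v (≤-trans ≤4 (+-monoˡ-≤ 2 d))

    agreement-positive : ∀ S a b → 𝟙 (S b) ≤ agreement S a b
    agreement-positive S a b with S b
    ... | false = z≤n
    ... | true = count-member (λ i → H b i ≡ᵇ H a i) (shared-right a b)

    degree-sum-excess : ∀ S a →
      sum (λ i → degree S (i , H a i)) ≡ sum (λ b → agreement S a b ∸ 𝟙 (S b)) + count S
    degree-sum-excess S a =
      trans (degree-sum S a) (sum-∸ (agreement S a) (λ b → 𝟙 (S b)) (agreement-positive S a))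

    degree-sum-bound : ∀ S a → T (S a) → (r ∸ 1) + count S ≤ sum (λ i → degree S (i , H a i))
    degree-sum-bound S a Sa = begin
      (r ∸ 1) + count S
        ≡⟨ cong₂ (λ x y → x ∸ y + count S) (agreement-self S a Sa) (𝟙-true Sa) ⟨
      (agreement S a a ∸ 𝟙 (S a)) + count S
        ≤⟨ +-monoˡ-≤ _ (term≤sum (λ b → agreement S a b ∸ 𝟙 (S b)) a) ⟩
      sum (λ b → agreement S a b ∸ 𝟙 (S b)) + count S
        ≡⟨ degree-sum-excess S a ⟨
      sum (λ i → degree S (i , H a i))
        ∎
      where open ≤-Reasoning

two∤seven : ¬ (2 ∣ 7)
two∤seven 2∣7 with () ← n∣m⇒m%n≡0 7 2 2∣7

module SixPartite {m : ℕ} (H : Hypergraph 6 m) (intersecting : Intersecting H) where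
  open Incidence H

  -- Seven edges in which every vertex has degree at most two do not exist:
  -- counting degrees along an edge a gives 5 + 7 = 6 · 2, so every vertex of
  -- a has degree exactly two; then the edges pair up according to their
  -- vertex in column 0, and 7 would be even.
  no-seven-edges-of-degree-2 : ∀ S → count S ≡ 7 → (∀ a i → T (S a) → degree S (i , H a i) ≤ 2) → ⊥
  no-seven-edges-of-degree-2 S |S|≡7 ≤2 =
    two∤seven (subst (2 ∣_) all-paired (classes-divisible 2 7 S (≤-reflexive |S|≡7)))
    where
    open Multiplicity (λ b → H b zero)
    degree-2 : ∀ a → T (S a) → degree S (zero , H a zero) ≡ 2
    degree-2 a Sa = sum-saturated-above (λ i → degree S (i , H a i)) 2 (λ i → ≤2 a i Sa)
      (subst (λ s → 5 + s ≤ sum (λ i → degree S (i , H a i))) |S|≡7 (degree-sum-bound intersecting S a Sa)) zero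
    all-paired : with-multiplicity 2 S ≡ 7
    all-paired = trans (count-cong pointwise) |S|≡7
      where
      pointwise : ∀ a → S a ∧ (multiplicity S (H a zero) ≡ᵇ 2) ≡ S a
      pointwise a with S a in Sa
      ... | false = refl
      ... | true = cong (_≡ᵇ 2) (degree-2 a (from T-≡ Sa))

  -- Greedy covering: remove a vertex of degree three if there is one, else
  -- a vertex of degree two; seven edges without either are impossible.
  capacity-3-7 : CoverCapacity 3 7
  capacity-3-7 S ≤7 with count S ≤? 4
  ... | yes ≤4 = capacity-weaken (n≤1+n 2) (capacity-2-4 intersecting) S ≤4
  ... | no ≰4 with any? (λ a → T? (S a) ×-dec any? (λ i → 3 ≤? degree S (i , H a i)))
  ...   | yes (a , _ , i , d≥3) =
    capacity-step (capacity-2-4 intersecting) S (i , H a i) (≤-trans ≤7 (+-monoˡ-≤ 4 d≥3))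
  ...   | no no-degree-3 with count S ≤? 6
  ...     | yes ≤6 = let (v , d) = vertex-of-degree-2 intersecting S (≤-trans (m≤n+m 2 3) (≰⇒> ≰4)) in
    capacity-step (capacity-2-4 intersecting) S v (≤-trans ≤6 (+-monoˡ-≤ 4 d))
  ...     | no ≰6 = ⊥-elim (no-seven-edges-of-degree-2 S (≤-antisym ≤7 (≰⇒> ≰6))
    λ a i Sa → ≤-pred (≰⇒> λ d≥3 → no-degree-3 (a , Sa , i , d≥3)))

-- If any n edges can be covered by
-- k vertices, then a list C of at most t − k vertices meets at most m − n − 1
-- edges: otherwise the at most n edges it misses could be covered by k more.
module Uncoverable {r m : ℕ} (H : Hypergraph r m) (t : ℕ)
                   (uncoverable : ∀ C → length C ≤ t → ¬ Incidence.Covers H C (Incidence.all-edges H)) where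
  open Incidence H

  covered-bound : ∀ {k n} → CoverCapacity k n → ∀ C → length C + k ≤ t → reach C + suc n ≤ m
  covered-bound {k} {n} capacity C |C|+k≤t with count (not ∘ covers C) ≤? n
  ... | no ≰n = ≤-trans (+-monoʳ-≤ _ (≰⇒> ≰n))
                  (≤-reflexive (trans (count-split all-edges (covers C)) (count-all all-edges _)))
  ... | yes ≤n =
    let (C' , |C'|≤k , cover) = capacity (not ∘ covers C) ≤n
        |C++C'|≤t = ≤-trans (≤-reflexive (length-++ C)) (≤-trans (+-monoʳ-≤ (length C) |C'|≤k) |C|+k≤t)
    in ⊥-elim (uncoverable (C ++ C') |C++C'|≤t
         λ a _ → subst T (sym (covers-++ C C' a)) (either (covers C a) (cover a)))
    where
    either : ∀ x {y} → (T (not x) → T y) → T (x ∨ y)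
    either true _ = _
    either false y = y _

module TwelveEdges (H : Hypergraph 6 12) (intersecting : Intersecting H)
                   (uncoverable : ∀ C → length C ≤ 4 → ¬ Incidence.Covers H C (Incidence.all-edges H)) where
  open Incidence H
  open Uncoverable H 4 uncoverable

  reach-1 : ∀ C → length C ≤ 1 → reach C ≤ 4
  reach-1 C |C|≤1 =
    +-cancelʳ-≤ 8 _ 4 (covered-bound (SixPartite.capacity-3-7 H intersecting) C (+-monoˡ-≤ 3 |C|≤1))

  reach-2 : ∀ C → length C ≤ 2 → reach C ≤ 7
  reach-2 C |C|≤2 = +-cancelʳ-≤ 5 _ 7 (covered-bound (capacity-2-4 intersecting) C (+-monoˡ-≤ 2 |C|≤2))

  reach-3 : ∀ C → length C ≤ 3 → reach C ≤ 9
  reach-3 C |C|≤3 = +-cancelʳ-≤ 3 _ 9 (covered-bound (capacity-1-2 intersecting) C (+-monoˡ-≤ 1 |C|≤3))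

  reach-4 : ∀ C → length C ≤ 4 → reach C ≤ 11
  reach-4 C |C|≤4 =
    +-cancelʳ-≤ 1 _ 11 (covered-bound capacity-zero C (≤-trans (≤-reflexive (+-identityʳ _)) |C|≤4))

  deg : Vertex 6 → ℕ
  deg v = count (v ∈ᵇ_)

  reach-single : ∀ v → reach (v ∷ []) ≡ deg v
  reach-single v = count-cong (λ a → ∨-identityʳ (v ∈ᵇ a))

  deg≤4 : ∀ v → deg v ≤ 4
  deg≤4 v = subst (_≤ 4) (reach-single v) (reach-1 (v ∷ []) ≤-refl)

  deg≥1 : ∀ a i → 1 ≤ deg (i , H a i)
  deg≥1 a i = count-member ((i , H a i) ∈ᵇ_) (own-vertex a i)

  module Column (i : Fin 6) where

    d : Fin 12 → ℕ
    d a = deg (i , H a i)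

    c : ℕ → ℕ
    c j = count (λ a → d a ≡ᵇ j)

    column : List ℕ → List (Vertex 6)
    column = map (i ,_)

    column-covers : ∀ L {a b} → H a i ≡ H b i → covers (column L) a ≡ covers (column L) b
    column-covers [] _ = refl
    column-covers (x ∷ L) same = cong₂ _∨_ (cong (_≡ᵇ x) same) (column-covers L same)

    column-degree : ∀ {j} L → All (λ x → deg (i , x) ≡ j) L → ∀ a → T (covers (column L) a) → d a ≡ j
    column-degree (x ∷ L) (dx ∷ degs) a met with H a i ≡ᵇ x in on
    ... | true = trans (cong (λ y → deg (i , y)) (≡ᵇ-true _ _ on)) dx
    ... | false = column-degree L degs a met

    -- Vertices of one column lie on disjoint sets of edges, so the vertex of
    -- an edge b missed by the column vertices adds its whole degree.
    extend : ∀ L b → ¬ T (covers (column L) b) → reach (column (H b i ∷ L)) ≡ d b + reach (column L)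
    extend L b missed = begin
      reach (column (H b i ∷ L))                                       ≡⟨ +-identityʳ _ ⟨
      reach (column (H b i ∷ L)) + 0                                   ≡⟨ cong (reach (column (H b i ∷ L)) +_) disjoint ⟨
      reach (column (H b i ∷ L)) + count (λ a → ((i , H b i) ∈ᵇ a) ∧ covers (column L) a)
                                                                       ≡⟨ reach-cons (i , H b i) (column L) ⟩
      d b + reach (column L)                                           ∎
      where
      open ≡-Reasoning
      disjoint : count (λ a → ((i , H b i) ∈ᵇ a) ∧ covers (column L) a) ≡ 0
      disjoint = count-none (λ a → ((i , H b i) ∈ᵇ a) ∧ covers (column L) a) λ a t →
        let (on , met) = to T-∧ t in
        missed (subst T (column-covers L (≡ᵇ⇒≡ _ _ on)) met)

    missed-edge : ∀ j L → reach (column L) < c j → ∃ λ b → d b ≡ j × ¬ T (covers (column L) b)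
    missed-edge j L fewer =
      let (b , db , missed) = count-difference (λ a → d a ≡ᵇ j) (covers (column L)) fewer in
      b , ≡ᵇ⇒≡ _ _ db , missed

    pack : ∀ j k → k * j < c j →
           ∃ λ L → length L ≡ suc k × All (λ x → deg (i , x) ≡ j) L × reach (column L) ≡ suc k * j
    pack j zero room =
      let (b , db , missed) = missed-edge j [] room in
      H b i ∷ [] , refl , db ∷ [] , trans (extend [] b missed) (cong (_+ 0) db)
    pack j (suc k) room =
      let (L , |L| , degs , reach≡) = pack j k (≤-trans (s≤s (m≤n+m (k * j) j)) room)
          (b , db , missed) = missed-edge j L (subst (_< c j) (sym reach≡) room)
      in H b i ∷ L , cong suc |L| , db ∷ degs , trans (extend L b missed) (cong₂ _+_ db reach≡)

    length-column : ∀ L {k} → length L ≡ k → length (column L) ≤ k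
    length-column L |L| = ≤-reflexive (trans (length-map (i ,_) L) |L|)

    -- Two vertices of degree 4 would meet 8 > 7 edges.
    c₄≤4 : c 4 ≤ 4
    c₄≤4 with c 4 ≤? 4
    ... | yes ≤4 = ≤4
    ... | no ≰4 = let (L , |L| , _ , reach≡8) = pack 4 1 (≰⇒> ≰4) in
      ⊥-elim (1+n≰n (subst (_≤ 7) reach≡8 (reach-2 (column L) (length-column L |L|))))

    -- Four vertices of degree 3 would meet 12 > 11 edges.
    c₃≤9 : c 3 ≤ 9
    c₃≤9 with c 3 ≤? 9
    ... | yes ≤9 = ≤9
    ... | no ≰9 = let (L , |L| , _ , reach≡12) = pack 3 3 (≰⇒> ≰9) in
      ⊥-elim (1+n≰n (subst (_≤ 11) reach≡12 (reach-4 (column L) (length-column L |L|))))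

    -- Two vertices of degree 3 and one of degree 4 would meet 10 > 9 edges.
    c₃≤3 : 1 ≤ c 4 → c 3 ≤ 3
    c₃≤3 some-4 with c 3 ≤? 3
    ... | yes ≤3 = ≤3
    ... | no ≰3 =
      let (L , |L| , degs , reach≡6) = pack 3 1 (≰⇒> ≰3)
          (b , db) = count-witness (λ a → d a ≡ᵇ 4) some-4
          missed : ¬ T (covers (column L) b)
          missed met = contradiction (trans (sym (≡ᵇ⇒≡ (d b) 4 db)) (column-degree L degs b met)) λ ()
          reach≡10 = trans (extend L b missed) (cong₂ _+_ (≡ᵇ⇒≡ (d b) 4 db) reach≡6)
      in ⊥-elim (1+n≰n (subst (_≤ 9) reach≡10
           (reach-3 (column (H b i ∷ L)) (length-column (H b i ∷ L) (cong suc |L|)))))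

    c₂-even : 2 ∣ c 2
    c₂-even = classes-divisible 2 12 all-edges ≤-refl
      where open Multiplicity (λ a → H a i)

    excess : ℕ
    excess = sum (λ a → d a ∸ 1)

    excess≡weight : excess ≡ column-weight (c 2) (c 3) (c 4)
    excess≡weight = begin
      sum (λ a → d a ∸ 1)
        ≡⟨ sum-cong-≗ (λ a → pointwise (d a) (deg≥1 a i) (deg≤4 (i , H a i))) ⟩
      sum (λ a → 3 * 𝟙 (d a ≡ᵇ 4) + 2 * 𝟙 (d a ≡ᵇ 3) + 𝟙 (d a ≡ᵇ 2))
        ≡⟨ ∑-distrib-+ (λ a → 3 * 𝟙 (d a ≡ᵇ 4) + 2 * 𝟙 (d a ≡ᵇ 3)) (λ a → 𝟙 (d a ≡ᵇ 2)) ⟩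
      sum (λ a → 3 * 𝟙 (d a ≡ᵇ 4) + 2 * 𝟙 (d a ≡ᵇ 3)) + c 2
        ≡⟨ cong (_+ c 2) (∑-distrib-+ (λ a → 3 * 𝟙 (d a ≡ᵇ 4)) (λ a → 2 * 𝟙 (d a ≡ᵇ 3))) ⟩
      sum (λ a → 3 * 𝟙 (d a ≡ᵇ 4)) + sum (λ a → 2 * 𝟙 (d a ≡ᵇ 3)) + c 2
        ≡⟨ cong₂ (λ x y → x + y + c 2) (*-distribˡ-sum 3 (λ a → 𝟙 (d a ≡ᵇ 4)))
                                        (*-distribˡ-sum 2 (λ a → 𝟙 (d a ≡ᵇ 3))) ⟨
      3 * c 4 + 2 * c 3 + c 2
        ∎
      where
      open ≡-Reasoning
      pointwise : ∀ n → 1 ≤ n → n ≤ 4 → n ∸ 1 ≡ 3 * 𝟙 (n ≡ᵇ 4) + 2 * 𝟙 (n ≡ᵇ 3) + 𝟙 (n ≡ᵇ 2)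
      pointwise 1 _ _ = refl
      pointwise 2 _ _ = refl
      pointwise 3 _ _ = refl
      pointwise 4 _ _ = refl
      pointwise (suc (suc (suc (suc (suc _))))) _ (s≤s (s≤s (s≤s (s≤s ()))))

    profile≤12 : c 2 + c 3 + c 4 ≤ 12
    profile≤12 = begin
      c 2 + c 3 + c 4
        ≡⟨ cong (_+ c 4) (∑-distrib-+ (λ a → 𝟙 (d a ≡ᵇ 2)) (λ a → 𝟙 (d a ≡ᵇ 3))) ⟨
      sum (λ a → 𝟙 (d a ≡ᵇ 2) + 𝟙 (d a ≡ᵇ 3)) + c 4
        ≡⟨ ∑-distrib-+ (λ a → 𝟙 (d a ≡ᵇ 2) + 𝟙 (d a ≡ᵇ 3)) (λ a → 𝟙 (d a ≡ᵇ 4)) ⟨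
      sum (λ a → 𝟙 (d a ≡ᵇ 2) + 𝟙 (d a ≡ᵇ 3) + 𝟙 (d a ≡ᵇ 4))
        ≤⟨ sum-mono (λ a → exclusive (d a)) ⟩
      12 ∎
      where
      open ≤-Reasoning
      exclusive : ∀ n → 𝟙 (n ≡ᵇ 2) + 𝟙 (n ≡ᵇ 3) + 𝟙 (n ≡ᵇ 4) ≤ 1
      exclusive 0 = z≤n
      exclusive 1 = z≤n
      exclusive 2 = ≤-refl
      exclusive 3 = ≤-refl
      exclusive 4 = ≤-refl
      exclusive (suc (suc (suc (suc (suc _))))) = z≤n

    excess-bound : excess ≤ 22 × (excess ≡ 22 → 1 ≤ c 4)
    excess-bound = subst (λ w → w ≤ 22 × (w ≡ 22 → 1 ≤ c 4)) (sym excess≡weight)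
      (column-weight-bound (c 2) (c 3) (c 4) c₃≤9 c₄≤4 c₂-even profile≤12 c₃≤3)

  -- The excess along an edge a: the degrees of its six vertices, minus one
  -- each. Since a meets all 12 edges, its degrees sum to at least 5 + 12.
  edge-excess : Fin 12 → ℕ
  edge-excess a = sum (λ i → deg (i , H a i) ∸ 1)

  degree-sum-along : ∀ a → sum (λ i → deg (i , H a i)) ≡ edge-excess a + 6
  degree-sum-along a = sum-∸ (λ i → deg (i , H a i)) (λ _ → 1) (deg≥1 a)

  edge-excess≥11 : ∀ a → 11 ≤ edge-excess a
  edge-excess≥11 a = +-cancelʳ-≤ 6 11 _
    (≤-trans (degree-sum-bound intersecting all-edges a _) (≤-reflexive (degree-sum-along a)))

  -- Summing the excess by edges and by columns: 12 · 11 ≤ total ≤ 6 · 22,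
  -- so every column has excess exactly 22 and every edge exactly 11.
  total-excess : sum edge-excess ≡ sum Column.excess
  total-excess = ∑-comm (λ a i → deg (i , H a i) ∸ 1)

  column-excess≡22 : ∀ i → Column.excess i ≡ 22
  column-excess≡22 = sum-saturated-above Column.excess 22 (λ i → proj₁ (Column.excess-bound i))
    (≤-trans (sum-mono edge-excess≥11) (≤-reflexive total-excess))

  edge-excess≡11 : ∀ a → edge-excess a ≡ 11
  edge-excess≡11 = sum-saturated-below edge-excess 11 edge-excess≥11
    (≤-trans (≤-reflexive total-excess) (sum-mono (λ i → proj₁ (Column.excess-bound i))))

  -- Hence two distinct edges share exactly one vertex: the agreements of a
  -- with all edges sum to 6 + 11, of which a itself takes 6.
  agreement≤1 : ∀ {a b} → a ≢ b → agreement all-edges a b ≤ 1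
  agreement≤1 {a} {b} a≢b = m∸n≡0⇒m≤n (n≤0⇒n≡0 (+-cancelˡ-≤ 5 _ 0 (+-cancelʳ-≤ 12 _ 5 chain)))
    where
    open ≤-Reasoning
    chain : 5 + (agreement all-edges a b ∸ 1) + 12 ≤ 5 + 0 + 12
    chain = begin
      5 + (agreement all-edges a b ∸ 1) + 12
        ≡⟨ cong (λ s → s ∸ 1 + (agreement all-edges a b ∸ 1) + 12) (agreement-self all-edges a _) ⟨
      (agreement all-edges a a ∸ 1) + (agreement all-edges a b ∸ 1) + 12
        ≤⟨ +-monoˡ-≤ 12 (two-terms≤sum (λ c → agreement all-edges a c ∸ 1) a≢b) ⟩
      sum (λ c → agreement all-edges a c ∸ 1) + 12
        ≡⟨ degree-sum-excess intersecting all-edges a ⟨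
      sum (λ i → deg (i , H a i))
        ≡⟨ degree-sum-along a ⟩
      edge-excess a + 6
        ≡⟨ cong (_+ 6) (edge-excess≡11 a) ⟩
      17 ∎

  both : Vertex 6 → Vertex 6 → Fin 12 → Bool
  both v w a = (v ∈ᵇ a) ∧ (w ∈ᵇ a)

  reach-pair : ∀ v w → reach (v ∷ w ∷ []) + count (both v w) ≡ deg v + deg w
  reach-pair v w = begin
    reach (v ∷ w ∷ []) + count (both v w)
      ≡⟨ cong (reach (v ∷ w ∷ []) +_) (count-cong (λ a → cong ((v ∈ᵇ a) ∧_) (∨-identityʳ (w ∈ᵇ a)))) ⟨
    reach (v ∷ w ∷ []) + count (λ a → (v ∈ᵇ a) ∧ covers (w ∷ []) a)
      ≡⟨ reach-cons v (w ∷ []) ⟩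
    deg v + reach (w ∷ [])
      ≡⟨ cong (deg v +_) (reach-single w) ⟩
    deg v + deg w ∎
    where open ≡-Reasoning

  module Hubs (label : Fin 6 → ℕ) (hub-degree : ∀ i → deg (i , label i) ≡ 4) where

    hub : Fin 6 → Vertex 6
    hub i = i , label i

    -- Two hubs share an edge, since otherwise they would meet 8 > 7 edges ...
    hubs-meet : ∀ i j → 1 ≤ count (both (hub i) (hub j))
    hubs-meet i j with 1 ≤? count (both (hub i) (hub j))
    ... | yes ≥1 = ≥1
    ... | no ≱1 = ⊥-elim (1+n≰n (subst (_≤ 7) reach≡8 (reach-2 (hub i ∷ hub j ∷ []) ≤-refl)))
      where
      reach≡8 : reach (hub i ∷ hub j ∷ []) ≡ 8
      reach≡8 = begin
        reach (hub i ∷ hub j ∷ [])                                 ≡⟨ +-identityʳ _ ⟨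
        reach (hub i ∷ hub j ∷ []) + 0                             ≡⟨ cong (reach (hub i ∷ hub j ∷ []) +_) disjoint ⟨
        reach (hub i ∷ hub j ∷ []) + count (both (hub i) (hub j))  ≡⟨ reach-pair (hub i) (hub j) ⟩
        deg (hub i) + deg (hub j)                                  ≡⟨ cong₂ _+_ (hub-degree i) (hub-degree j) ⟩
        8                                                          ∎
        where
        open ≡-Reasoning
        disjoint : count (both (hub i) (hub j)) ≡ 0
        disjoint = n≤0⇒n≡0 (≤-pred (≰⇒> ≱1))

    -- ... and hubs in distinct columns share at most one edge, since two such
    -- edges would agree in two columns.
    hubs-meet-once : ∀ {i j} → i ≢ j → count (both (hub i) (hub j)) ≤ 1
    hubs-meet-once {i} {j} i≢j = count-at-most-one (both (hub i) (hub j)) λ {b} {c} b≢c tb tc →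
      let (bi , bj) = to T-∧ tb
          (ci , cj) = to T-∧ tc
          two-columns = count-two-members (λ k → H c k ≡ᵇ H b k) i≢j (agree-at bi ci) (agree-at bj cj)
      in <⇒≱ two-columns (agreement≤1 b≢c)

    -- No edge a contains three hubs: the three would meet at least
    -- 4 + 7 − 1 = 10 > 9 edges, since a is the only edge through the first
    -- hub and one of the others.
    no-three-hubs : ∀ {i j k} → i ≢ j → i ≢ k → j ≢ k →
                    ∀ a → T (hub i ∈ᵇ a) → T (hub j ∈ᵇ a) → T (hub k ∈ᵇ a) → ⊥
    no-three-hubs {i} {j} {k} i≢j i≢k j≢k a ai aj ak =
      1+n≰n (≤-trans ten (reach-3 (hub i ∷ hub j ∷ hub k ∷ []) ≤-refl))
      where
      open ≤-Reasoning
      seven : 7 ≤ reach (hub j ∷ hub k ∷ [])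
      seven = +-cancelʳ-≤ 1 7 _ (begin
        8                                                      ≡⟨ cong₂ _+_ (hub-degree j) (hub-degree k) ⟨
        deg (hub j) + deg (hub k)                              ≡⟨ reach-pair (hub j) (hub k) ⟨
        reach (hub j ∷ hub k ∷ []) + count (both (hub j) (hub k)) ≤⟨ +-monoʳ-≤ _ (hubs-meet-once j≢k) ⟩
        reach (hub j ∷ hub k ∷ []) + 1                         ∎)
      through-a : ∀ b → T ((hub i ∈ᵇ b) ∧ covers (hub j ∷ hub k ∷ []) b) → b ≡ a
      through-a b t with to (T-∧ {hub i ∈ᵇ b}) t
      ... | bi , met with to (T-∨ {hub j ∈ᵇ b}) met
      ...   | inj₁ bj = count≤1-unique _ (hubs-meet-once i≢j) (from T-∧ (bi , bj)) (from T-∧ (ai , aj))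
      ...   | inj₂ met′ with to (T-∨ {hub k ∈ᵇ b}) met′
      ...     | inj₁ bk = count≤1-unique _ (hubs-meet-once i≢k) (from T-∧ (bi , bk)) (from T-∧ (ai , ak))
      ...     | inj₂ ()
      ten : 10 ≤ reach (hub i ∷ hub j ∷ hub k ∷ [])
      only-a : count (λ b → (hub i ∈ᵇ b) ∧ covers (hub j ∷ hub k ∷ []) b) ≤ 1
      only-a = count-at-most-one _ λ b≢c tb tc → b≢c (trans (through-a _ tb) (sym (through-a _ tc)))
      ten = +-cancelʳ-≤ 1 10 _ (begin
        11
          ≤⟨ +-monoʳ-≤ 4 seven ⟩
        4 + reach (hub j ∷ hub k ∷ [])
          ≡⟨ cong (_+ reach (hub j ∷ hub k ∷ [])) (hub-degree i) ⟨
        deg (hub i) + reach (hub j ∷ hub k ∷ [])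
          ≡⟨ reach-cons (hub i) (hub j ∷ hub k ∷ []) ⟨
        reach (hub i ∷ hub j ∷ hub k ∷ []) + count (λ b → (hub i ∈ᵇ b) ∧ covers (hub j ∷ hub k ∷ []) b)
          ≤⟨ +-monoʳ-≤ _ only-a ⟩
        reach (hub i ∷ hub j ∷ hub k ∷ []) + 1
          ∎)

    -- The hub of column 0 shares an edge with each of the five other hubs,
    -- yet each of its four edges contains at most one other hub.
    impossible : ⊥
    impossible = 1+n≰n (begin
      5
        ≤⟨ sum-mono (λ j → hubs-meet zero (suc j)) ⟩
      sum (λ j → count (both (hub zero) (hub (suc j))))
        ≡⟨ ∑-comm (λ a j → 𝟙 (both (hub zero) (hub (suc j)) a)) ⟨
      sum (λ a → sum (λ j → 𝟙 (both (hub zero) (hub (suc j)) a)))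
        ≤⟨ sum-mono at-most-one-other ⟩
      deg (hub zero)
        ≡⟨ hub-degree zero ⟩
      4 ∎)
      where
      open ≤-Reasoning
      at-most-one-other : ∀ a → sum (λ j → 𝟙 (both (hub zero) (hub (suc j)) a)) ≤ 𝟙 (hub zero ∈ᵇ a)
      at-most-one-other a with hub zero ∈ᵇ a in on
      ... | false = z≤n
      ... | true = count-at-most-one (λ j → hub (suc j) ∈ᵇ a) λ {j} {k} j≢k tj tk →
        no-three-hubs {zero} {suc j} {suc k} (λ ()) (λ ()) (j≢k ∘ Fin-suc-injective) a (from T-≡ on) tj tk

  -- Every column does contain a hub, since its excess is 22.
  hub-in-column : ∀ i → ∃ λ a → T (Column.d i a ≡ᵇ 4)
  hub-in-column i = count-witness _ (proj₂ (Column.excess-bound i) (column-excess≡22 i))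

  impossible : ⊥
  impossible = Hubs.impossible (λ i → H (proj₁ (hub-in-column i)) i) (λ i → ≡ᵇ⇒≡ _ 4 (proj₂ (hub-in-column i)))

-- The theorem: τ(H) = 5 means in particular that no four vertices cover H.
lemma3 : ¬ (∃ λ (H : Hypergraph 6 12) → Simple H × Intersecting H × τ≡ H 5)
lemma3 (H , _ , intersecting , _ , no-smaller-cover) = TwelveEdges.impossible H intersecting uncoverable
  where
  open Incidence H
  uncoverable : ∀ C → length C ≤ 4 → ¬ Covers C all-edges
  uncoverable C |C|≤4 cover = no-smaller-cover C (λ a → covers-sound C a (cover a _)) (s≤s |C|≤4)
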